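{- Let $t_1,t_2$ be terms in the language $\langle\to,\neg,{}^+,{}^-,1\rangle$. The equation $t_1\approx(t_2\to1)\to1$ holds in all strong quasi-Wajsberg* algebras if and only if it holds in all Wajsberg* algebras.
   Context: A quasi-Wajsberg* algebra is an algebra $\langle W;\to,\neg,{}^+,{}^-,1\rangle$ of type $\langle2,1,1,1,0\rangle$ such that for all $x,y,z$: (QW*1) $x\to y=\neg y\to\neg x$; (QW*2) $(x\to1)\to((y\to1)\to z)=(y\to1)\to((x\to1)\to z)$; (QW*3) $(1\to x)\to1=1$; (QW*4) $(z\to z)\to(x\to y)=x\to y$; (QW*5) $(1\to1)\to x^+=((1\to1)\to x)^+=(x\to1)\to1$ and $(1\to1)\to x^-=((1\to1)\to x)^-=(x\to\neg1)\to\neg1$; (QW*6) $x\to y=(y^+\to x^-)\to(x^+\to y^-)$; (QW*7) $\neg(x\to y)=y\to x$; (QW*8) $\neg\neg x=x$; (QW*9) $(x\to(\neg x\to y))^+=x^+\to(\neg x^+\to y^+)$; (QW*10)–(QW*12) $\vee$ is commutative, associative, and $x\to(y\vee z)=(x\to y)\vee(x\to z)$; where $x\vee y:=((x^+\to y^+)^+\to(\neg x)^-)\to((y^-\to x^-)^-\to x^-)$. It is strong if $x^+=(1\to1)\to x^+$ and $x^-=(1\to1)\to x^-$ for all $x$. A Wajsberg* algebra is an algebra $\langle M;\to,\neg,1\rangle$ of type $\langle2,1,0\rangle$ satisfying for all $x,y,z$: $x\to y=\neg y\to\neg x$; $(x\to1)\to((y\to1)\to z)=(y\to1)\to((x\to1)\to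 z)$; $(1\to x)\to1=1$; $(y\to y)\to x=x$; $x\to y=(y^+\to x^-)\to(x^+\to y^-)$; $\neg(x\to y)=y\to x$; $\neg\neg x=x$; $(x\to(\neg x\to y))^+=x^+\to(\neg x^+\to y^+)$; $\vee$ commutative and associative; $x\to(y\vee z)=(x\to y)\vee(x\to z)$; where $x^+:=(x\to1)\to1$, $x^-:=(x\to\neg1)\to\neg1$. Wajsberg* algebras are regarded as algebras in the language $\langle\to,\neg,{}^+,{}^-,1\rangle$ with these term operations. -}

module Defs where

open import Data.Nat using (ℕ)
open import Relation.Binary.PropositionalEquality using (_≡_)
open import Data.Product using (_×_)

data Term : Set where
  var   : ℕ → Term
  _⇒_   : Term → Term → Term
  neg   : Term → Term
  plus  : Term → Term
  minus : Term → Term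
  one   : Term

infixr 5 _⇒_

module JoinOf {A : Set} (_⟶_ : A → A → A) (¬_ : A → A) (_⁺ _⁻ : A → A) where
  _∨_ : A → A → A
  x ∨ y = ((((x ⁺) ⟶ (y ⁺)) ⁺) ⟶ ((¬ x) ⁻)) ⟶ ((((y ⁻) ⟶ (x ⁻)) ⁻) ⟶ (x ⁻))

record QWStar : Set₁ where
  field
    Carrier : Set
    _⟶_ : Carrier → Carrier → Carrier
    ¬_  : Carrier → Carrier
    _⁺  : Carrier → Carrier
    _⁻  : Carrier → Carrier
    𝟏   : Carrier
  open JoinOf _⟶_ ¬_ _⁺ _⁻ public
  field
    qw1  : ∀ x y → x ⟶ y ≡ (¬ y) ⟶ (¬ x)
    qw2  : ∀ x y z → (x ⟶ 𝟏) ⟶ ((y ⟶ 𝟏) ⟶ z) ≡ (y ⟶ 𝟏) ⟶ ((x ⟶ 𝟏) ⟶ z)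
    qw3  : ∀ x → (𝟏 ⟶ x) ⟶ 𝟏 ≡ 𝟏
    qw4  : ∀ x y z → (z ⟶ z) ⟶ (x ⟶ y) ≡ x ⟶ y
    qw5a : ∀ x → (𝟏 ⟶ 𝟏) ⟶ (x ⁺) ≡ ((𝟏 ⟶ 𝟏) ⟶ x) ⁺
    qw5b : ∀ x → ((𝟏 ⟶ 𝟏) ⟶ x) ⁺ ≡ (x ⟶ 𝟏) ⟶ 𝟏
    qw5c : ∀ x → (𝟏 ⟶ 𝟏) ⟶ (x ⁻) ≡ ((𝟏 ⟶ 𝟏) ⟶ x) ⁻
    qw5d : ∀ x → ((𝟏 ⟶ 𝟏) ⟶ x) ⁻ ≡ (x ⟶ (¬ 𝟏)) ⟶ (¬ 𝟏)
    qw6  : ∀ x y → x ⟶ y ≡ ((y ⁺) ⟶ (x ⁻)) ⟶ ((x ⁺) ⟶ (y ⁻))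
    qw7  : ∀ x y → ¬ (x ⟶ y) ≡ y ⟶ x
    qw8  : ∀ x → ¬ (¬ x) ≡ x
    qw9  : ∀ x y → (x ⟶ ((¬ x) ⟶ y)) ⁺ ≡ (x ⁺) ⟶ ((¬ (x ⁺)) ⟶ (y ⁺))
    qw10 : ∀ x y → x ∨ y ≡ y ∨ x
    qw11 : ∀ x y z → x ∨ (y ∨ z) ≡ (x ∨ y) ∨ z
    qw12 : ∀ x y z → x ⟶ (y ∨ z) ≡ (x ⟶ y) ∨ (x ⟶ z)

IsStrong : QWStar → Set
IsStrong A = (∀ x → x ⁺ ≡ (𝟏 ⟶ 𝟏) ⟶ (x ⁺)) × (∀ x → x ⁻ ≡ (𝟏 ⟶ 𝟏) ⟶ (x ⁻))
  where
    open QWStar A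

record WStar : Set₁ where
  field
    Carrier : Set
    _⟶_ : Carrier → Carrier → Carrier
    ¬_  : Carrier → Carrier
    𝟏   : Carrier
  _⁺ : Carrier → Carrier
  x ⁺ = (x ⟶ 𝟏) ⟶ 𝟏
  _⁻ : Carrier → Carrier
  x ⁻ = (x ⟶ (¬ 𝟏)) ⟶ (¬ 𝟏)
  open JoinOf _⟶_ ¬_ _⁺ _⁻ public
  field
    w1  : ∀ x y → x ⟶ y ≡ (¬ y) ⟶ (¬ x)
    w2  : ∀ x y z → (x ⟶ 𝟏) ⟶ ((y ⟶ 𝟏) ⟶ z) ≡ (y ⟶ 𝟏) ⟶ ((x ⟶ 𝟏) ⟶ z)
    w3  : ∀ x → (𝟏 ⟶ x) ⟶ 𝟏 ≡ 𝟏
    w4  : ∀ x y → (y ⟶ y) ⟶ x ≡ x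
    w5  : ∀ x y → x ⟶ y ≡ ((y ⁺) ⟶ (x ⁻)) ⟶ ((x ⁺) ⟶ (y ⁻))
    w6  : ∀ x y → ¬ (x ⟶ y) ≡ y ⟶ x
    w7  : ∀ x → ¬ (¬ x) ≡ x
    w8  : ∀ x y → (x ⟶ ((¬ x) ⟶ y)) ⁺ ≡ (x ⁺) ⟶ ((¬ (x ⁺)) ⟶ (y ⁺))
    w9  : ∀ x y → x ∨ y ≡ y ∨ x
    w10 : ∀ x y z → x ∨ (y ∨ z) ≡ (x ∨ y) ∨ z
    w11 : ∀ x y z → x ⟶ (y ∨ z) ≡ (x ⟶ y) ∨ (x ⟶ z)

evalWith : {A : Set} → (A → A → A) → (A → A) → (A → A) → (A → A) → A
         → (ℕ → A) → Term → A
evalWith i n p m o ρ (var k)   = ρ k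
evalWith i n p m o ρ (t ⇒ u)   = i (evalWith i n p m o ρ t) (evalWith i n p m o ρ u)
evalWith i n p m o ρ (neg t)   = n (evalWith i n p m o ρ t)
evalWith i n p m o ρ (plus t)  = p (evalWith i n p m o ρ t)
evalWith i n p m o ρ (minus t) = m (evalWith i n p m o ρ t)
evalWith i n p m o ρ one       = o

evalQW : (A : QWStar) → (ℕ → QWStar.Carrier A) → Term → QWStar.Carrier A
evalQW A = evalWith _⟶_ ¬_ _⁺ _⁻ 𝟏 where open QWStar A

evalW : (W : WStar) → (ℕ → WStar.Carrier W) → Term → WStar.Carrier W
evalW W = evalWith _⟶_ ¬_ _⁺ _⁻ 𝟏 where open WStar W

_⊨QW_≈_ : QWStar → Term → Term → Set
A ⊨QW t₁ ≈ t₂ = ∀ (ρ : ℕ → QWStar.Carrier A) → evalQW A ρ t₁ ≡ evalQW A ρ t₂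

_⊨W_≈_ : WStar → Term → Term → Set
W ⊨W t₁ ≈ t₂ = ∀ (ρ : ℕ → WStar.Carrier W) → evalW W ρ t₁ ≡ evalW W ρ t₂

-- Every Wajsberg* algebra is a strong quasi-Wajsberg* algebra, which gives one
-- direction.  For the other, call x regular when (1 → 1) → x = x.  In a strong
-- algebra the regular elements form a Wajsberg* algebra and x ↦ (1 → 1) → x is a
-- homomorphism onto it; every term other than a variable under negations denotes
-- a regular element, so equations between such terms transfer.  A variable under
-- negations can take the value −1 in the three-element Wajsberg* algebra on
-- {−1, 0, 1}, where (x → 1) → 1 never does, so for such a t₁ the hypothesis fails.
module Submission where

open import Defs
open import Data.Nat using (ℕ)
open import Data.Product using (Σ; _×_; _,_; ∃; proj₁; proj₂)
open import Data.Sum using (_⊎_; inj₁; inj₂)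
open import Axiom.UniquenessOfIdentityProofs.WithK using (uip)
open import Function using (_∘_)
open import Data.Empty using (⊥; ⊥-elim)
open import Relation.Nullary using (Dec; yes; no)
open import Relation.Nullary.Decidable using (map′; _×-dec_; from-yes)
open import Relation.Binary.Definitions using (DecidableEquality)
open import Relation.Binary.PropositionalEquality
open ≡-Reasoning

data Literal : Term → Set where
  var : ∀ k → Literal (var k)
  neg : ∀ {t} → Literal t → Literal (neg t)

data Regular : Term → Set where
  _⇒_   : ∀ t u → Regular (t ⇒ u)
  neg   : ∀ {t} → Regular t → Regular (neg t)
  plus  : ∀ t → Regular (plus t)
  minus : ∀ t → Regular (minus t)
  one   : Regular one

regular-or-literal : ∀ t → Regular t ⊎ Literal t
regular-or-literal (var k)   = inj₂ (var k)
regular-or-literal (t ⇒ u)   = inj₁ (t ⇒ u)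
regular-or-literal (neg t)   with regular-or-literal t
... | inj₁ r = inj₁ (neg r)
... | inj₂ l = inj₂ (neg l)
regular-or-literal (plus t)  = inj₁ (plus t)
regular-or-literal (minus t) = inj₁ (minus t)
regular-or-literal one       = inj₁ one

toQWStar : WStar → QWStar
toQWStar W = record
  { Carrier = Carrier ; _⟶_ = _⟶_ ; ¬_ = ¬_ ; _⁺ = _⁺ ; _⁻ = _⁻ ; 𝟏 = 𝟏
  ; qw1 = w1 ; qw2 = w2 ; qw3 = w3 ; qw4 = λ x y z → w4 (x ⟶ y) z
  ; qw5a = λ x → trans (w4 (x ⁺) 𝟏) (cong _⁺ (sym (w4 x 𝟏)))
  ; qw5b = λ x → cong _⁺ (w4 x 𝟏)
  ; qw5c = λ x → trans (w4 (x ⁻) 𝟏) (cong _⁻ (sym (w4 x 𝟏)))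
  ; qw5d = λ x → cong _⁻ (w4 x 𝟏)
  ; qw6 = w5 ; qw7 = w6 ; qw8 = w7 ; qw9 = w8 ; qw10 = w9 ; qw11 = w10 ; qw12 = w11
  }
  where open WStar W

toQWStar-isStrong : ∀ W → IsStrong (toQWStar W)
toQWStar-isStrong W = (λ x → sym (w4 (x ⁺) 𝟏)) , (λ x → sym (w4 (x ⁻) 𝟏))
  where open WStar W

strong-valid⇒W-valid : ∀ t₁ t₂ → (∀ A → IsStrong A → A ⊨QW t₁ ≈ t₂) → ∀ W → W ⊨W t₁ ≈ t₂
strong-valid⇒W-valid _ _ valid W = valid (toQWStar W) (toQWStar-isStrong W)

∨-cong : ∀ {C : Set} (_⟶_ : C → C → C) (¬_ : C → C) {p p′ m m′ : C → C} →
         p ≗ p′ → m ≗ m′ →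
         ∀ x y → JoinOf._∨_ _⟶_ ¬_ p m x y ≡ JoinOf._∨_ _⟶_ ¬_ p′ m′ x y
∨-cong _⟶_ ¬_ {p} {m = m} p≗p′ m≗m′ x y =
  cong₂ _⟶_ (cong₂ _⟶_ (trans (cong p (cong₂ _⟶_ (p≗p′ x) (p≗p′ y))) (p≗p′ _)) (m≗m′ (¬ x)))
            (cong₂ _⟶_ (trans (cong m (cong₂ _⟶_ (m≗m′ y) (m≗m′ x))) (m≗m′ _)) (m≗m′ x))

module RegularElements (A : QWStar) where
  open QWStar A

  reg : Carrier → Carrier
  reg x = (𝟏 ⟶ 𝟏) ⟶ x

  IsRegular : Carrier → Set
  IsRegular x = reg x ≡ x

  ⟶-regular : ∀ x y → IsRegular (x ⟶ y)
  ⟶-regular x y = qw4 x y 𝟏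

  reg-regular : ∀ x → IsRegular (reg x)
  reg-regular = ⟶-regular (𝟏 ⟶ 𝟏)

  𝟏-regular : IsRegular 𝟏
  𝟏-regular = qw3 𝟏

  reg-¬ : ∀ x → reg (¬ x) ≡ ¬ (reg x)
  reg-¬ x = begin
    (𝟏 ⟶ 𝟏) ⟶ (¬ x)         ≡⟨ qw1 (𝟏 ⟶ 𝟏) (¬ x) ⟩
    (¬ (¬ x)) ⟶ (¬ (𝟏 ⟶ 𝟏)) ≡⟨ cong₂ _⟶_ (qw8 x) (qw7 𝟏 𝟏) ⟩
    x ⟶ (𝟏 ⟶ 𝟏)             ≡⟨ sym (qw7 (𝟏 ⟶ 𝟏) x) ⟩
    ¬ (reg x)               ∎

  ¬-regular : ∀ {x} → IsRegular x → IsRegular (¬ x)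
  ¬-regular {x} x-reg = trans (reg-¬ x) (cong ¬_ x-reg)

  ⟶-identityˡ-regular : ∀ {x} y → IsRegular x → (y ⟶ y) ⟶ x ≡ x
  ⟶-identityˡ-regular {x} y x-reg = begin
    (y ⟶ y) ⟶ x     ≡⟨ cong ((y ⟶ y) ⟶_) (sym x-reg) ⟩
    (y ⟶ y) ⟶ reg x ≡⟨ qw4 (𝟏 ⟶ 𝟏) x y ⟩
    reg x           ≡⟨ x-reg ⟩
    x               ∎

module RegularPart (A : QWStar) (strong : IsStrong A) where
  open QWStar A
  open RegularElements A

  ⁺-regular : ∀ x → IsRegular (x ⁺)
  ⁺-regular x = sym (proj₁ strong x)

  ⁻-regular : ∀ x → IsRegular (x ⁻)
  ⁻-regular x = sym (proj₂ strong x)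

  ⁺-reg : ∀ x → reg x ⁺ ≡ x ⁺
  ⁺-reg x = trans (sym (qw5a x)) (⁺-regular x)

  ⁻-reg : ∀ x → reg x ⁻ ≡ x ⁻
  ⁻-reg x = trans (sym (qw5c x)) (⁻-regular x)

  _⁺ᵗ _⁻ᵗ : Carrier → Carrier
  x ⁺ᵗ = (x ⟶ 𝟏) ⟶ 𝟏
  x ⁻ᵗ = (x ⟶ (¬ 𝟏)) ⟶ (¬ 𝟏)

  open JoinOf _⟶_ ¬_ _⁺ᵗ _⁻ᵗ renaming (_∨_ to _∨ᵗ_)

  ⁺ᵗ≗⁺ : ∀ x → x ⁺ᵗ ≡ x ⁺
  ⁺ᵗ≗⁺ x = trans (sym (qw5b x)) (⁺-reg x)

  ⁻ᵗ≗⁻ : ∀ x → x ⁻ᵗ ≡ x ⁻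
  ⁻ᵗ≗⁻ x = trans (sym (qw5d x)) (⁻-reg x)

  ∨ᵗ≗∨ : ∀ x y → x ∨ᵗ y ≡ x ∨ y
  ∨ᵗ≗∨ = ∨-cong _⟶_ ¬_ ⁺ᵗ≗⁺ ⁻ᵗ≗⁻

  ⟶-bounds-cong : ∀ {p p′ m m′ : Carrier → Carrier} → p ≗ p′ → m ≗ m′ → ∀ x y →
                  ((p y) ⟶ (m x)) ⟶ ((p x) ⟶ (m y)) ≡ ((p′ y) ⟶ (m′ x)) ⟶ ((p′ x) ⟶ (m′ y))
  ⟶-bounds-cong p≗p′ m≗m′ x y =
    cong₂ _⟶_ (cong₂ _⟶_ (p≗p′ y) (m≗m′ x)) (cong₂ _⟶_ (p≗p′ x) (m≗m′ y))

  reg-⟶-reg : ∀ x y → (reg x) ⟶ (reg y) ≡ x ⟶ y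
  reg-⟶-reg x y = begin
    (reg x) ⟶ (reg y)                                     ≡⟨ qw6 (reg x) (reg y) ⟩
    ((reg y ⁺) ⟶ (reg x ⁻)) ⟶ ((reg x ⁺) ⟶ (reg y ⁻))     ≡⟨ ⟶-bounds-cong ⁺-reg ⁻-reg x y ⟩
    ((y ⁺) ⟶ (x ⁻)) ⟶ ((x ⁺) ⟶ (y ⁻))                     ≡⟨ sym (qw6 x y) ⟩
    x ⟶ y                                                 ∎

  Reg : Set
  Reg = Σ Carrier IsRegular

  value-injective : {x y : Reg} → proj₁ x ≡ proj₁ y → x ≡ y
  value-injective {x , x-reg} {.x , x-reg′} refl = cong (x ,_) (uip x-reg x-reg′)

  regularPart : WStar
  regularPart = record
    { Carrier = Reg
    ; _⟶_ = λ (x , _) (y , _) → x ⟶ y , ⟶-regular x y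
    ; ¬_  = λ (x , x-reg) → ¬ x , ¬-regular x-reg
    ; 𝟏   = 𝟏 , 𝟏-regular
    ; w1  = λ (x , _) (y , _) → value-injective (qw1 x y)
    ; w2  = λ (x , _) (y , _) (z , _) → value-injective (qw2 x y z)
    ; w3  = λ (x , _) → value-injective (qw3 x)
    ; w4  = λ (x , x-reg) (y , _) → value-injective (⟶-identityˡ-regular y x-reg)
    ; w5  = λ (x , _) (y , _) → value-injective
              (trans (qw6 x y) (sym (⟶-bounds-cong ⁺ᵗ≗⁺ ⁻ᵗ≗⁻ x y)))
    ; w6  = λ (x , _) (y , _) → value-injective (qw7 x y)
    ; w7  = λ (x , _) → value-injective (qw8 x)
    ; w8  = λ (x , _) (y , _) → value-injective (⁺ᵗ-law x y)
    ; w9  = λ (x , _) (y , _) → value-injective (∨ᵗ-comm x y)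
    ; w10 = λ (x , _) (y , _) (z , _) → value-injective (∨ᵗ-assoc x y z)
    ; w11 = λ (x , _) (y , _) (z , _) → value-injective (⟶-distribˡ-∨ᵗ x y z)
    }
    where
    ⁺ᵗ-law : ∀ x y → (x ⟶ ((¬ x) ⟶ y)) ⁺ᵗ ≡ (x ⁺ᵗ) ⟶ ((¬ (x ⁺ᵗ)) ⟶ (y ⁺ᵗ))
    ⁺ᵗ-law x y = begin
      (x ⟶ ((¬ x) ⟶ y)) ⁺ᵗ         ≡⟨ ⁺ᵗ≗⁺ _ ⟩
      (x ⟶ ((¬ x) ⟶ y)) ⁺          ≡⟨ qw9 x y ⟩
      (x ⁺) ⟶ ((¬ (x ⁺)) ⟶ (y ⁺))  ≡⟨ sym (cong₂ (λ a b → a ⟶ ((¬ a) ⟶ b)) (⁺ᵗ≗⁺ x) (⁺ᵗ≗⁺ y)) ⟩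
      (x ⁺ᵗ) ⟶ ((¬ (x ⁺ᵗ)) ⟶ (y ⁺ᵗ)) ∎

    ∨ᵗ-comm : ∀ x y → x ∨ᵗ y ≡ y ∨ᵗ x
    ∨ᵗ-comm x y = begin
      x ∨ᵗ y ≡⟨ ∨ᵗ≗∨ x y ⟩
      x ∨ y  ≡⟨ qw10 x y ⟩
      y ∨ x  ≡⟨ sym (∨ᵗ≗∨ y x) ⟩
      y ∨ᵗ x ∎

    ∨ᵗ-assoc : ∀ x y z → x ∨ᵗ (y ∨ᵗ z) ≡ (x ∨ᵗ y) ∨ᵗ z
    ∨ᵗ-assoc x y z = begin
      x ∨ᵗ (y ∨ᵗ z) ≡⟨ cong (x ∨ᵗ_) (∨ᵗ≗∨ y z) ⟩
      x ∨ᵗ (y ∨ z)  ≡⟨ ∨ᵗ≗∨ x _ ⟩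
      x ∨ (y ∨ z)   ≡⟨ qw11 x y z ⟩
      (x ∨ y) ∨ z   ≡⟨ sym (∨ᵗ≗∨ _ z) ⟩
      (x ∨ y) ∨ᵗ z  ≡⟨ cong (_∨ᵗ z) (sym (∨ᵗ≗∨ x y)) ⟩
      (x ∨ᵗ y) ∨ᵗ z ∎

    ⟶-distribˡ-∨ᵗ : ∀ x y z → x ⟶ (y ∨ᵗ z) ≡ (x ⟶ y) ∨ᵗ (x ⟶ z)
    ⟶-distribˡ-∨ᵗ x y z = begin
      x ⟶ (y ∨ᵗ z)          ≡⟨ cong (x ⟶_) (∨ᵗ≗∨ y z) ⟩
      x ⟶ (y ∨ z)           ≡⟨ qw12 x y z ⟩
      (x ⟶ y) ∨ (x ⟶ z)     ≡⟨ sym (∨ᵗ≗∨ _ _) ⟩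
      (x ⟶ y) ∨ᵗ (x ⟶ z)    ∎

  toReg : Carrier → Reg
  toReg x = reg x , reg-regular x

  eval-toReg : ∀ ρ t → proj₁ (evalW regularPart (toReg ∘ ρ) t) ≡ reg (evalQW A ρ t)
  eval-toReg ρ (var k)   = refl
  eval-toReg ρ (t ⇒ u)   = begin
    _ ⟶ _                                  ≡⟨ cong₂ _⟶_ (eval-toReg ρ t) (eval-toReg ρ u) ⟩
    (reg (evalQW A ρ t)) ⟶ (reg (evalQW A ρ u)) ≡⟨ reg-⟶-reg _ _ ⟩
    (evalQW A ρ t) ⟶ (evalQW A ρ u)         ≡⟨ sym (⟶-regular _ _) ⟩
    reg ((evalQW A ρ t) ⟶ (evalQW A ρ u))   ∎
  eval-toReg ρ (neg t)   = trans (cong ¬_ (eval-toReg ρ t)) (sym (reg-¬ _))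
  eval-toReg ρ (plus t)  =
    trans (cong _⁺ᵗ (eval-toReg ρ t)) (trans (⁺ᵗ≗⁺ _) (trans (⁺-reg _) (sym (⁺-regular _))))
  eval-toReg ρ (minus t) =
    trans (cong _⁻ᵗ (eval-toReg ρ t)) (trans (⁻ᵗ≗⁻ _) (trans (⁻-reg _) (sym (⁻-regular _))))
  eval-toReg ρ one       = sym 𝟏-regular

  regular-term-regular : ∀ {t} → Regular t → ∀ ρ → IsRegular (evalQW A ρ t)
  regular-term-regular (t ⇒ u)   ρ = ⟶-regular _ _
  regular-term-regular (neg r)   ρ = ¬-regular (regular-term-regular r ρ)
  regular-term-regular (plus t)  ρ = ⁺-regular _
  regular-term-regular (minus t) ρ = ⁻-regular _
  regular-term-regular one       ρ = 𝟏-regular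

W-valid⇒strong-valid : ∀ {t₁ t₂} → Regular t₁ → Regular t₂ →
                       (∀ W → W ⊨W t₁ ≈ t₂) → ∀ A → IsStrong A → A ⊨QW t₁ ≈ t₂
W-valid⇒strong-valid {t₁} {t₂} r₁ r₂ valid A strong ρ = begin
  evalQW A ρ t₁                       ≡⟨ sym (regular-term-regular r₁ ρ) ⟩
  reg (evalQW A ρ t₁)                 ≡⟨ sym (eval-toReg ρ t₁) ⟩
  proj₁ (evalW regularPart ρ′ t₁)     ≡⟨ cong proj₁ (valid regularPart ρ′) ⟩
  proj₁ (evalW regularPart ρ′ t₂)     ≡⟨ eval-toReg ρ t₂ ⟩
  reg (evalQW A ρ t₂)                 ≡⟨ regular-term-regular r₂ ρ ⟩
  evalQW A ρ t₂                       ∎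
  where
  open RegularElements A
  open RegularPart A strong
  ρ′ : ℕ → Reg
  ρ′ = toReg ∘ ρ

data Trit : Set where
  −1 0ₜ +1 : Trit

infix 4 _≟_
_≟_ : DecidableEquality Trit
−1 ≟ −1 = yes refl
−1 ≟ 0ₜ = no λ ()
−1 ≟ +1 = no λ ()
0ₜ ≟ −1 = no λ ()
0ₜ ≟ 0ₜ = yes refl
0ₜ ≟ +1 = no λ ()
+1 ≟ −1 = no λ ()
+1 ≟ 0ₜ = no λ ()
+1 ≟ +1 = yes refl

∀-Trit? : {P : Trit → Set} → (∀ x → Dec (P x)) → Dec (∀ x → P x)
∀-Trit? P? = map′ (λ { (a , b , c) → λ { −1 → a ; 0ₜ → b ; +1 → c } })
                  (λ f → f −1 , f 0ₜ , f +1)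
                  (P? −1 ×-dec P? 0ₜ ×-dec P? +1)

-- x ⇒ y is y − x truncated to {−1, 0, +1}.
infixr 5 _⇒ₜ_
_⇒ₜ_ : Trit → Trit → Trit
0ₜ ⇒ₜ y  = y
−1 ⇒ₜ −1 = 0ₜ
−1 ⇒ₜ _  = +1
+1 ⇒ₜ +1 = 0ₜ
+1 ⇒ₜ _  = −1

negₜ : Trit → Trit
negₜ −1 = +1
negₜ 0ₜ = 0ₜ
negₜ +1 = −1

negₜ-involutive : ∀ x → negₜ (negₜ x) ≡ x
negₜ-involutive −1 = refl
negₜ-involutive 0ₜ = refl
negₜ-involutive +1 = refl

Trit-WStar : WStar
Trit-WStar = record
  { Carrier = Trit ; _⟶_ = _⇒ₜ_ ; ¬_ = negₜ ; 𝟏 = +1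
  ; w1  = from-yes (∀₂? λ x y → x ⇒ₜ y ≟ negₜ y ⇒ₜ negₜ x)
  ; w2  = from-yes (∀₃? λ x y z → (x ⇒ₜ +1) ⇒ₜ (y ⇒ₜ +1) ⇒ₜ z ≟ (y ⇒ₜ +1) ⇒ₜ (x ⇒ₜ +1) ⇒ₜ z)
  ; w3  = from-yes (∀-Trit? λ x → (+1 ⇒ₜ x) ⇒ₜ +1 ≟ +1)
  ; w4  = from-yes (∀₂? λ x y → (y ⇒ₜ y) ⇒ₜ x ≟ x)
  ; w5  = from-yes (∀₂? λ x y → x ⇒ₜ y ≟ (y ⁺ ⇒ₜ x ⁻) ⇒ₜ (x ⁺ ⇒ₜ y ⁻))
  ; w6  = from-yes (∀₂? λ x y → negₜ (x ⇒ₜ y) ≟ y ⇒ₜ x)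
  ; w7  = negₜ-involutive
  ; w8  = from-yes (∀₂? λ x y → (x ⇒ₜ negₜ x ⇒ₜ y) ⁺ ≟ x ⁺ ⇒ₜ negₜ (x ⁺) ⇒ₜ y ⁺)
  ; w9  = from-yes (∀₂? λ x y → x ∨ y ≟ y ∨ x)
  ; w10 = from-yes (∀₃? λ x y z → x ∨ (y ∨ z) ≟ (x ∨ y) ∨ z)
  ; w11 = from-yes (∀₃? λ x y z → x ⇒ₜ (y ∨ z) ≟ (x ⇒ₜ y) ∨ (x ⇒ₜ z))
  }
  where
  ∀₂? : {P : Trit → Trit → Set} → (∀ x y → Dec (P x y)) → Dec (∀ x y → P x y)
  ∀₂? P? = ∀-Trit? λ x → ∀-Trit? (P? x)
  ∀₃? : {P : Trit → Trit → Trit → Set} → (∀ x y z → Dec (P x y z)) → Dec (∀ x y z → P x y z)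
  ∀₃? P? = ∀-Trit? λ x → ∀₂? (P? x)
  _⁺ _⁻ : Trit → Trit
  x ⁺ = (x ⇒ₜ +1) ⇒ₜ +1
  x ⁻ = (x ⇒ₜ negₜ +1) ⇒ₜ negₜ +1
  open JoinOf _⇒ₜ_ negₜ _⁺ _⁻

⁺ₜ≢−1 : ∀ x → (x ⇒ₜ +1) ⇒ₜ +1 ≢ −1
⁺ₜ≢−1 −1 ()
⁺ₜ≢−1 0ₜ ()
⁺ₜ≢−1 +1 ()

literal-surjective : ∀ {t} → Literal t → ∀ a → ∃ λ ρ → evalW Trit-WStar ρ t ≡ a
literal-surjective (var k) a = (λ _ → a) , refl
literal-surjective (neg l) a with literal-surjective l (negₜ a)
... | ρ , t≡¬a = ρ , trans (cong negₜ t≡¬a) (negₜ-involutive a)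

literal≉⁺ : ∀ {t} u → Literal t → Trit-WStar ⊨W t ≈ ((u ⇒ one) ⇒ one) → ⊥
literal≉⁺ u l valid with literal-surjective l −1
... | ρ , t≡−1 = ⁺ₜ≢−1 (evalW Trit-WStar ρ u) (trans (sym (valid ρ)) t≡−1)

corollary3p3 : (t₁ t₂ : Term) →
    ((∀ (A : QWStar) → IsStrong A → A ⊨QW t₁ ≈ ((t₂ ⇒ one) ⇒ one))
      → (∀ (W : WStar) → W ⊨W t₁ ≈ ((t₂ ⇒ one) ⇒ one)))
    × ((∀ (W : WStar) → W ⊨W t₁ ≈ ((t₂ ⇒ one) ⇒ one))
      → (∀ (A : QWStar) → IsStrong A → A ⊨QW t₁ ≈ ((t₂ ⇒ one) ⇒ one)))
corollary3p3 t₁ t₂ = strong-valid⇒W-valid t₁ t₂⁺ , W-valid⇒strong-valid′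
  where
  t₂⁺ : Term
  t₂⁺ = (t₂ ⇒ one) ⇒ one
  W-valid⇒strong-valid′ : (∀ W → W ⊨W t₁ ≈ t₂⁺) → ∀ A → IsStrong A → A ⊨QW t₁ ≈ t₂⁺
  W-valid⇒strong-valid′ with regular-or-literal t₁
  ... | inj₁ r₁ = W-valid⇒strong-valid r₁ ((t₂ ⇒ one) ⇒ one)
  ... | inj₂ l₁ = λ valid → ⊥-elim (literal≉⁺ t₂ l₁ (valid Trit-WStar))
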